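{- Let $G$ be a simple graph that is not Laman-sparse. Then $G$ contains a rigid component on at least four vertices that is contained in the $(3+2)$-core of $G$.
   Context: A graph with $n$ vertices and $m$ edges is Laman-sparse if every subgraph spanning $n'\ge 2$ vertices and $m'$ edges satisfies $m'\le 2n'-3$; it is a Laman graph if in addition $m=2n-3$; it is Laman-spanning if it contains a spanning Laman subgraph. A rigid block of $G$ is a vertex set whose induced subgraph is Laman-spanning; a rigid component is an inclusion-wise maximal rigid block. The $3$-core of a graph is its maximal induced subgraph of minimum degree at least $3$; the $(3+2)$-core is the maximal induced subgraph obtained by starting from the $3$-core and repeatedly adding any vertex having at least two neighbours in the subgraph built so far. -}

module Defs where

open import Data.Nat using (ℕ; _+_; _*_; _≤_; _<ᵇ_)
open import Data.Bool using (Bool; true; false; _∧_; if_then_else_)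
open import Data.Fin using (Fin; toℕ)
open import Data.Fin.Subset using (Subset; _∈_; _⊆_; ∣_∣; ⊤)
open import Data.Vec using (lookup)
open import Data.List using (map; allFin)
open import Data.Nat.ListAction using (sum)
open import Data.Product using (Σ; _×_)
open import Relation.Binary.PropositionalEquality using (_≡_)
open import Relation.Nullary using (¬_)

record SimpleGraph (n : ℕ) : Set where
  field
    adj    : Fin n → Fin n → Bool
    sym    : ∀ i j → adj i j ≡ adj j i
    irrefl : ∀ i → adj i i ≡ false
open SimpleGraph public

EdgeRel : ℕ → Set
EdgeRel n = Fin n → Fin n → Bool

count : ∀ {n} → (Fin n → Bool) → ℕ
count {n} p = sum (map (λ i → if p i then 1 else 0) (allFin n))

edgeCount : ∀ {n} → EdgeRel n → ℕ
edgeCount {n} F = sum (map (λ i → count (λ j → (toℕ i <ᵇ toℕ j) ∧ F i j)) (allFin n))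

record SubgraphOf {n : ℕ} (T : Subset n) (H : EdgeRel n)
                  (S : Subset n) (F : EdgeRel n) : Set where
  field
    vertices⊆ : S ⊆ T
    edgeSym   : ∀ i j → F i j ≡ F j i
    edges⊆    : ∀ i j → F i j ≡ true → H i j ≡ true
    endpoints : ∀ i j → F i j ≡ true → (i ∈ S) × (j ∈ S)

LamanSparse : ∀ {n} → Subset n → EdgeRel n → Set
LamanSparse T H = ∀ S F → SubgraphOf T H S F → 2 ≤ ∣ S ∣ → edgeCount F + 3 ≤ 2 * ∣ S ∣

Laman : ∀ {n} → Subset n → EdgeRel n → Set
Laman T H = LamanSparse T H × (edgeCount H + 3 ≡ 2 * ∣ T ∣)

LamanSpanning : ∀ {n} → Subset n → EdgeRel n → Set
LamanSpanning T H = Σ (EdgeRel _) (λ F → SubgraphOf T H T F × Laman T F)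

inducedEdges : ∀ {n} → SimpleGraph n → Subset n → EdgeRel n
inducedEdges G S i j = adj G i j ∧ lookup S i ∧ lookup S j

GraphLamanSparse : ∀ {n} → SimpleGraph n → Set
GraphLamanSparse G = LamanSparse ⊤ (adj G)

RigidBlock : ∀ {n} → SimpleGraph n → Subset n → Set
RigidBlock G S = LamanSpanning S (inducedEdges G S)

RigidComponent : ∀ {n} → SimpleGraph n → Subset n → Set
RigidComponent G S = RigidBlock G S × (∀ S' → RigidBlock G S' → S ⊆ S' → S' ⊆ S)

degIn : ∀ {n} → SimpleGraph n → Subset n → Fin n → ℕ
degIn G S v = count (λ u → adj G v u ∧ lookup S u)

MinDegree3 : ∀ {n} → SimpleGraph n → Subset n → Set
MinDegree3 G S = ∀ v → v ∈ S → 3 ≤ degIn G S v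

IsThreeCore : ∀ {n} → SimpleGraph n → Subset n → Set
IsThreeCore G S = MinDegree3 G S × (∀ T → MinDegree3 G T → T ⊆ S)

-- vertices of the (3+2)-core, given the 3-core C: the closure of C under
-- adding a vertex with at least two (distinct) neighbours already in the set.
data InCore32 {n : ℕ} (G : SimpleGraph n) (C : Subset n) : Fin n → Set where
  base : ∀ {v} → v ∈ C → InCore32 G C v
  step : ∀ {v} (u w : Fin n) → ¬ (u ≡ w) →
         adj G v u ≡ true → adj G v w ≡ true →
         InCore32 G C u → InCore32 G C w → InCore32 G C v

module Submission where

-- Call S overfull if |S| ≥ 2 and G[S] has more than 2|S| - 3 edges. As G is not
-- Laman-sparse some set is overfull; take a smallest one, S. Deleting a vertex of degree
-- at most two would leave a smaller overfull set, so G[S] has minimum degree three: S lies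
-- in the 3-core C and |S| ≥ 4. Minimality also makes any 2|S| - 3 edges of G[S] a Laman
-- graph, so S is a rigid block, and a largest rigid block R ⊇ S is a rigid component.
-- Finally, with L a spanning Laman subgraph of R, repeatedly delete a vertex outside C
-- with at most two neighbours in the current set plus C. The current set stays tight for
-- L, so each deleted vertex has exactly two neighbours among the remaining ones; once no
-- such vertex exists the rest is absorbed by C. Read backwards, R lies in the (3+2)-core.

open import Defs renaming (sym to adj-sym)

open import Data.Bool using (Bool; true; false; _∧_; _∨_; not; if_then_else_)
import Data.Bool.Properties as Bool using (_≟_)
open import Data.Bool.Properties using (∧-identityʳ; ∧-zeroʳ; ∧-comm; ∧-assoc; ∨-comm)
open import Data.Fin using (Fin; zero; suc; toℕ)
open import Data.Fin.Subset using (Subset; _∈_; _⊆_; _∪_; ∣_∣; ⊤)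
open import Data.Fin.Subset.Properties using (anySubset?; _⊆?_; _∈?_; p⊂q⇒∣p∣<∣q∣; p⊆q⇒∣p∣≤∣q∣; ∣p∣≤n; p⊆p∪q; q⊆p∪q; x∈p∪q⁻)
open import Data.Vec using (Vec; []; _∷_; lookup; tabulate)
open import Data.Vec.Properties using (lookup∘tabulate; []=⇒lookup; lookup⇒[]=)
open import Data.Fin.Properties using (_≟_; all?; any?)
open import Data.Nat using (ℕ; zero; suc; _+_; _*_; _∸_; _≤_; _<_; _<ᵇ_; z≤n; s≤s)
open import Data.Nat.Properties hiding (_≟_)
open import Data.Nat.Tactic.RingSolver using (solve-∀)
open import Data.Nat.Properties using () renaming (_≟_ to _≟ℕ_)
open import Data.Product using (Σ; ∃; _×_; _,_; proj₁; proj₂)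
open import Data.Empty using (⊥-elim)
open import Data.Sum using (_⊎_; inj₁; inj₂)
open import Function using (_∘_)
open import Relation.Nullary using (¬_; Dec; yes; no; does)
open import Relation.Nullary.Decidable using (dec-true; dec-false; _×-dec_; _→-dec_; ¬?)
import Relation.Nullary.Decidable as Dec
open import Relation.Binary.PropositionalEquality
import Data.List as List using (tabulate; map; allFin)
import Data.List.Properties as List using (map-tabulate; map-cong)
import Data.Nat.ListAction as ListAction
open import Algebra.Properties.CommutativeMonoid.Sum +-0-commutativeMonoid
  using (sum-syntax; sum-cong-≗; ∑-distrib-+; sum-replicate-zero) renaming (sum to ∑)

𝟙 : Bool → ℕ
𝟙 b = if b then 1 else 0

_=ᶠ_ : ∀ {n} → Fin n → Fin n → Bool
i =ᶠ j = does (i ≟ j)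

listSum≡∑ : ∀ {n} (f : Fin n → ℕ) → ListAction.sum (List.map f (List.allFin n)) ≡ ∑[ i < n ] f i
listSum≡∑ {n} f = trans (cong ListAction.sum (List.map-tabulate (λ i → i) f)) (tabulated f)
  where
  tabulated : ∀ {m} (g : Fin m → ℕ) → ListAction.sum (List.tabulate g) ≡ ∑[ i < m ] g i
  tabulated {zero} g = refl
  tabulated {suc m} g = cong (g zero +_) (tabulated (g ∘ suc))

count≡∑ : ∀ {n} (p : Fin n → Bool) → count p ≡ ∑[ i < n ] 𝟙 (p i)
count≡∑ p = listSum≡∑ (𝟙 ∘ p)

∑-mono : ∀ {n} {f g : Fin n → ℕ} → (∀ i → f i ≤ g i) → ∑[ i < n ] f i ≤ ∑[ i < n ] g i
∑-mono {zero} f≤g = z≤n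
∑-mono {suc n} f≤g = +-mono-≤ (f≤g zero) (∑-mono (f≤g ∘ suc))

∑-point : ∀ {n} (g : Fin n → ℕ) (v : Fin n) → ∑[ i < n ] (if i =ᶠ v then g i else 0) ≡ g v
∑-point {suc n} g zero = trans (cong (g zero +_) (sum-replicate-zero n)) (+-identityʳ (g zero))
∑-point {suc n} g (suc v) = ∑-point (g ∘ suc) v

∑-remove : ∀ {n} (f : Fin n → ℕ) (v : Fin n) →
  ∑[ i < n ] f i ≡ f v + ∑[ i < n ] (if i =ᶠ v then 0 else f i)
∑-remove {n} f v = begin
    ∑[ i < n ] f i
  ≡⟨ sum-cong-≗ split ⟩
    ∑[ i < n ] ((if i =ᶠ v then f i else 0) + (if i =ᶠ v then 0 else f i))
  ≡⟨ ∑-distrib-+ (λ i → if i =ᶠ v then f i else 0) (λ i → if i =ᶠ v then 0 else f i) ⟩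
    ∑[ i < n ] (if i =ᶠ v then f i else 0) + ∑[ i < n ] (if i =ᶠ v then 0 else f i)
  ≡⟨ cong (_+ ∑[ i < n ] (if i =ᶠ v then 0 else f i)) (∑-point f v) ⟩
    f v + ∑[ i < n ] (if i =ᶠ v then 0 else f i)
  ∎
  where
  open ≡-Reasoning
  split : ∀ i → f i ≡ (if i =ᶠ v then f i else 0) + (if i =ᶠ v then 0 else f i)
  split i with i =ᶠ v
  ... | true = sym (+-identityʳ (f i))
  ... | false = refl

∑-witness : ∀ {n} (f : Fin n → ℕ) → 0 < ∑[ i < n ] f i → ∃ λ i → 0 < f i
∑-witness {suc n} f pos with f zero in eq
... | zero = let (i , fi) = ∑-witness (f ∘ suc) pos in suc i , fi
... | suc _ = zero , subst (0 <_) (sym eq) (s≤s z≤n)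

∧-true : ∀ {a b} → a ∧ b ≡ true → a ≡ true × b ≡ true
∧-true {true} {true} _ = refl , refl

𝟙-mono : ∀ {a b} → (a ≡ true → b ≡ true) → 𝟙 a ≤ 𝟙 b
𝟙-mono {false} a⇒b = z≤n
𝟙-mono {true} a⇒b rewrite a⇒b refl = ≤-refl

count-mono : ∀ {n} {p q : Fin n → Bool} → (∀ i → p i ≡ true → q i ≡ true) → count p ≤ count q
count-mono {p = p} {q} p⇒q rewrite count≡∑ p | count≡∑ q = ∑-mono (λ i → 𝟙-mono (p⇒q i))

count-cong : ∀ {n} {p q : Fin n → Bool} → (∀ i → p i ≡ q i) → count p ≡ count q
count-cong {p = p} {q} p≡q = cong ListAction.sum (List.map-cong (cong 𝟙 ∘ p≡q) (List.allFin _))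

count-witness : ∀ {n} (p : Fin n → Bool) → 0 < count p → ∃ λ i → p i ≡ true
count-witness p pos with ∑-witness (𝟙 ∘ p) (subst (0 <_) (count≡∑ p) pos)
... | i , 𝟙pi = i , positive 𝟙pi
  where
  positive : ∀ {b} → 0 < 𝟙 b → b ≡ true
  positive {true} _ = refl

count-remove : ∀ {n} (p : Fin n → Bool) (v : Fin n) →
  count p ≡ 𝟙 (p v) + count (λ i → p i ∧ not (i =ᶠ v))
count-remove {n} p v = begin
    count p
  ≡⟨ count≡∑ p ⟩
    ∑[ i < n ] 𝟙 (p i)
  ≡⟨ ∑-remove (𝟙 ∘ p) v ⟩
    𝟙 (p v) + ∑[ i < n ] (if i =ᶠ v then 0 else 𝟙 (p i))
  ≡⟨ cong (𝟙 (p v) +_) (sum-cong-≗ away) ⟩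
    𝟙 (p v) + ∑[ i < n ] 𝟙 (p i ∧ not (i =ᶠ v))
  ≡⟨ cong (𝟙 (p v) +_) (count≡∑ (λ i → p i ∧ not (i =ᶠ v))) ⟨
    𝟙 (p v) + count (λ i → p i ∧ not (i =ᶠ v))
  ∎
  where
  open ≡-Reasoning
  away : ∀ i → (if i =ᶠ v then 0 else 𝟙 (p i)) ≡ 𝟙 (p i ∧ not (i =ᶠ v))
  away i with i =ᶠ v
  ... | true = cong 𝟙 (sym (∧-zeroʳ (p i)))
  ... | false = cong 𝟙 (sym (∧-identityʳ (p i)))

count-two : ∀ {n} (p : Fin n → Bool) → 2 ≤ count p →
  ∃ λ u → ∃ λ w → ¬ u ≡ w × p u ≡ true × p w ≡ true
count-two p two =
  let (u , pu) = count-witness p (≤-trans (s≤s z≤n) two)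
      (w , pw≠u) = count-witness (λ i → p i ∧ not (i =ᶠ u)) (away u pu)
      (pw , w≠u) = ∧-true pw≠u
  in u , w , distinct w≠u , pu , pw
  where
  away : ∀ u → p u ≡ true → 0 < count (λ i → p i ∧ not (i =ᶠ u))
  away u pu = +-cancelˡ-≤ 1 1 _ (subst (2 ≤_) (trans (count-remove p u) (cong (λ b → 𝟙 b + rest) pu)) two)
    where rest = count (λ i → p i ∧ not (i =ᶠ u))
  distinct : ∀ {u w} → not (w =ᶠ u) ≡ true → ¬ u ≡ w
  distinct {u} w≠u refl rewrite dec-true (u ≟ u) refl with w≠u
  ... | ()

∈⇒true : ∀ {n} {i : Fin n} {S : Subset n} → i ∈ S → lookup S i ≡ true
∈⇒true = []=⇒lookup

true⇒∈ : ∀ {n} {i : Fin n} {S : Subset n} → lookup S i ≡ true → i ∈ S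
true⇒∈ {i = i} {S} = lookup⇒[]= i S

∣∣≡count : ∀ {n} (S : Subset n) → ∣ S ∣ ≡ count (lookup S)
∣∣≡count S = trans (∣∣≡∑ S) (sym (count≡∑ (lookup S)))
  where
  ∣∣≡∑ : ∀ {n} (S : Subset n) → ∣ S ∣ ≡ ∑[ i < n ] 𝟙 (lookup S i)
  ∣∣≡∑ [] = refl
  ∣∣≡∑ (true ∷ S) = cong suc (∣∣≡∑ S)
  ∣∣≡∑ (false ∷ S) = ∣∣≡∑ S

_∖_ : ∀ {n} → Subset n → Fin n → Subset n
S ∖ v = tabulate (λ i → lookup S i ∧ not (i =ᶠ v))

lookup-∖ : ∀ {n} (S : Subset n) (v i : Fin n) → lookup (S ∖ v) i ≡ (lookup S i ∧ not (i =ᶠ v))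
lookup-∖ S v i = lookup∘tabulate _ i

∣∖∣ : ∀ {n} {S : Subset n} {v : Fin n} → v ∈ S → suc ∣ S ∖ v ∣ ≡ ∣ S ∣
∣∖∣ {S = S} {v} v∈S = begin
    suc ∣ S ∖ v ∣
  ≡⟨ cong suc (trans (∣∣≡count (S ∖ v)) (count-cong (lookup-∖ S v))) ⟩
    suc (count (λ i → lookup S i ∧ not (i =ᶠ v)))
  ≡⟨ cong (λ b → 𝟙 b + count (λ i → lookup S i ∧ not (i =ᶠ v))) (∈⇒true v∈S) ⟨
    𝟙 (lookup S v) + count (λ i → lookup S i ∧ not (i =ᶠ v))
  ≡⟨ trans (∣∣≡count S) (count-remove (lookup S) v) ⟨
    ∣ S ∣
  ∎
  where open ≡-Reasoning

member : ∀ {n} (S : Subset n) → 0 < ∣ S ∣ → ∃ λ v → v ∈ S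
member S nonempty = let (v , Sv) = count-witness (lookup S) (subst (0 <_) (∣∣≡count S) nonempty) in v , true⇒∈ Sv

∖⊆ : ∀ {n} {S : Subset n} {v : Fin n} → S ∖ v ⊆ S
∖⊆ {S = S} {v} {i} i∈S∖v = true⇒∈ (proj₁ (∧-true (trans (sym (lookup-∖ S v i)) (∈⇒true i∈S∖v))))

∈∖ : ∀ {n} {S : Subset n} {v i : Fin n} → i ∈ S → ¬ i ≡ v → i ∈ S ∖ v
∈∖ {S = S} {v} {i} i∈S i≢v =
  true⇒∈ (trans (lookup-∖ S v i) (cong₂ (λ a b → a ∧ not b) (∈⇒true i∈S) (dec-false (i ≟ v) i≢v)))

-- The strict order on Fin n used by edgeCount to count each edge {i , j} once.
_≺_ : ∀ {n} → Fin n → Fin n → Bool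
i ≺ j = toℕ i <ᵇ toℕ j

≺-irrefl : ∀ {n} (i : Fin n) → (i ≺ i) ≡ false
≺-irrefl zero = refl
≺-irrefl (suc i) = ≺-irrefl i

≺-asym : ∀ {n} (i j : Fin n) → (i ≺ j) ≡ true → (j ≺ i) ≡ false
≺-asym zero (suc j) _ = refl
≺-asym (suc i) (suc j) i≺j = ≺-asym i j i≺j

≺-connex : ∀ {n} (i j : Fin n) → ¬ i ≡ j →
  ((i ≺ j) ≡ true × (j ≺ i) ≡ false) ⊎ ((i ≺ j) ≡ false × (j ≺ i) ≡ true)
≺-connex zero zero i≢j = ⊥-elim (i≢j refl)
≺-connex zero (suc j) _ = inj₁ (refl , refl)
≺-connex (suc i) zero _ = inj₂ (refl , refl)
≺-connex (suc i) (suc j) i≢j = ≺-connex i j (i≢j ∘ cong suc)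

Symmetric : ∀ {n} → EdgeRel n → Set
Symmetric F = ∀ i j → F i j ≡ F j i

edgeTerm : ∀ {n} → EdgeRel n → Fin n → Fin n → ℕ
edgeTerm F i j = 𝟙 (i ≺ j ∧ F i j)

edgeCount≡∑∑ : ∀ {n} (F : EdgeRel n) → edgeCount F ≡ ∑[ i < n ] ∑[ j < n ] edgeTerm F i j
edgeCount≡∑∑ F = trans (listSum≡∑ (λ i → count (λ j → i ≺ j ∧ F i j))) (sum-cong-≗ (λ i → count≡∑ (λ j → i ≺ j ∧ F i j)))

edgeCount-mono : ∀ {n} {F H : EdgeRel n} → (∀ i j → F i j ≡ true → H i j ≡ true) → edgeCount F ≤ edgeCount H
edgeCount-mono {F = F} {H} F⊆H rewrite edgeCount≡∑∑ F | edgeCount≡∑∑ H =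
  ∑-mono (λ i → ∑-mono (λ j → 𝟙-mono (λ e → let (i≺j , Fij) = ∧-true e in cong₂ _∧_ i≺j (F⊆H i j Fij))))

edgeCount-cong : ∀ {n} {F H : EdgeRel n} → (∀ i j → F i j ≡ H i j) → edgeCount F ≡ edgeCount H
edgeCount-cong F≡H = ≤-antisym (edgeCount-mono (λ i j → trans (sym (F≡H i j))))
                               (edgeCount-mono (λ i j → trans (F≡H i j)))

deleteVertex : ∀ {n} → EdgeRel n → Fin n → EdgeRel n
deleteVertex F v i j = F i j ∧ not (i =ᶠ v) ∧ not (j =ᶠ v)

edgeCount-deleteVertex : ∀ {n} (F : EdgeRel n) (v : Fin n) → Symmetric F → F v v ≡ false →
  edgeCount F ≡ count (F v) + edgeCount (deleteVertex F v)
edgeCount-deleteVertex {n} F v F-sym Fvv = begin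
    edgeCount F
  ≡⟨ edgeCount≡∑∑ F ⟩
    ∑[ i < n ] row i
  ≡⟨ ∑-remove row v ⟩
    row v + ∑[ i < n ] (if i =ᶠ v then 0 else row i)
  ≡⟨ cong (row v +_) (sum-cong-≗ rowAway) ⟩
    row v + ∑[ i < n ] (column i + ∑[ j < n ] T′ i j)
  ≡⟨ cong (row v +_) (∑-distrib-+ column (λ i → ∑[ j < n ] T′ i j)) ⟩
    row v + (∑[ i < n ] column i + ∑[ i < n ] ∑[ j < n ] T′ i j)
  ≡⟨ +-assoc (row v) _ _ ⟨
    row v + ∑[ i < n ] column i + ∑[ i < n ] ∑[ j < n ] T′ i j
  ≡⟨ cong₂ _+_ (sym (∑-distrib-+ (T v) column)) (sym (edgeCount≡∑∑ (deleteVertex F v))) ⟩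
    ∑[ j < n ] (T v j + column j) + edgeCount (deleteVertex F v)
  ≡⟨ cong (_+ edgeCount (deleteVertex F v)) (trans (sum-cong-≗ degreeTerm) (sym (count≡∑ (F v)))) ⟩
    count (F v) + edgeCount (deleteVertex F v)
  ∎
  where
  open ≡-Reasoning
  T = edgeTerm F
  T′ = edgeTerm (deleteVertex F v)
  row : Fin n → ℕ
  row i = ∑[ j < n ] T i j
  column : Fin n → ℕ
  column i = if i =ᶠ v then 0 else T i v
  -- the pair (v , v) contributes nothing, and every other pair at v is one edge at v
  degreeTerm : ∀ j → T v j + column j ≡ 𝟙 (F v j)
  degreeTerm j with j ≟ v
  ... | yes refl rewrite ≺-irrefl v | Fvv = refl
  ... | no j≢v with ≺-connex v j (j≢v ∘ sym)
  ...   | inj₁ (v≺j , j⊀v) rewrite v≺j | j⊀v = +-identityʳ _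
  ...   | inj₂ (v⊀j , j≺v) rewrite v⊀j | j≺v = cong 𝟙 (F-sym j v)
  rowAway : ∀ i → (if i =ᶠ v then 0 else row i) ≡ column i + ∑[ j < n ] T′ i j
  rowAway i with i ≟ v
  ... | yes refl = sym (trans (sum-cong-≗ noEdge) (sum-replicate-zero n))
    where
    noEdge : ∀ j → 𝟙 (v ≺ j ∧ F v j ∧ not true ∧ not (j =ᶠ v)) ≡ 0
    noEdge j rewrite ∧-zeroʳ (F v j) | ∧-zeroʳ (v ≺ j) = refl
  ... | no i≢v = trans (∑-remove (T i) v) (cong (T i v +_) (sum-cong-≗ entry))
    where
    entry : ∀ j → (if j =ᶠ v then 0 else T i j) ≡ 𝟙 (i ≺ j ∧ F i j ∧ not (j =ᶠ v))
    entry j with j =ᶠ v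
    ... | true rewrite ∧-zeroʳ (F i j) | ∧-zeroʳ (i ≺ j) = refl
    ... | false rewrite ∧-identityʳ (F i j) = refl

restrict : ∀ {n} → EdgeRel n → Subset n → EdgeRel n
restrict F X i j = F i j ∧ lookup X i ∧ lookup X j

restrict-sym : ∀ {n} {F : EdgeRel n} (X : Subset n) → Symmetric F → Symmetric (restrict F X)
restrict-sym {F = F} X F-sym i j
  rewrite F-sym i j | ∧-comm (lookup X i) (lookup X j) = refl

restrict⊆ : ∀ {n} (F : EdgeRel n) (X : Subset n) {i j : Fin n} → restrict F X i j ≡ true → F i j ≡ true
restrict⊆ F X {i} e = proj₁ (∧-true {F i _} e)

restrict-ends : ∀ {n} (F : EdgeRel n) (X : Subset n) {i j : Fin n} → restrict F X i j ≡ true → i ∈ X × j ∈ X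
restrict-ends F X {i} {j} e = let (Xi , Xj) = ∧-true (proj₂ (∧-true {F i j} e)) in true⇒∈ Xi , true⇒∈ Xj

edgeCount-restrict-∖ : ∀ {n} (F : EdgeRel n) (X : Subset n) {v : Fin n} → Symmetric F → F v v ≡ false → v ∈ X →
  edgeCount (restrict F X) ≡ count (λ u → F v u ∧ lookup X u) + edgeCount (restrict F (X ∖ v))
edgeCount-restrict-∖ F X {v} F-sym Fvv v∈X =
  trans (edgeCount-deleteVertex (restrict F X) v (restrict-sym X F-sym) (cong (_∧ _) Fvv))
        (cong₂ _+_ (count-cong degree) (edgeCount-cong deleted))
  where
  degree : ∀ u → restrict F X v u ≡ (F v u ∧ lookup X u)
  degree u rewrite ∈⇒true v∈X = refl
  interchange : ∀ a b c d e → (a ∧ b ∧ c) ∧ d ∧ e ≡ a ∧ (b ∧ d) ∧ (c ∧ e)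
  interchange false _ _ _ _ = refl
  interchange true false _ _ _ = refl
  interchange true true c d e rewrite ∧-comm c (d ∧ e) | ∧-assoc d e c | ∧-comm e c = refl
  deleted : ∀ i j → deleteVertex (restrict F X) v i j ≡ restrict F (X ∖ v) i j
  deleted i j rewrite lookup-∖ X v i | lookup-∖ X v j =
    interchange (F i j) (lookup X i) (lookup X j) (not (i =ᶠ v)) (not (j =ᶠ v))

theEdge : ∀ {n} → Fin n → Fin n → EdgeRel n
theEdge a b i j = (i =ᶠ a ∧ j =ᶠ b) ∨ (i =ᶠ b ∧ j =ᶠ a)

deleteEdge : ∀ {n} → EdgeRel n → Fin n → Fin n → EdgeRel n
deleteEdge F a b i j = F i j ∧ not (theEdge a b i j)

=ᶠ⇒≡ : ∀ {n} {i j : Fin n} → (i =ᶠ j) ≡ true → i ≡ j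
=ᶠ⇒≡ {i = i} {j} eq with i ≟ j
... | yes i≡j = i≡j

=ᶠ-pair : ∀ {n} {i j a b : Fin n} → (i =ᶠ a ∧ j =ᶠ b) ≡ true → i ≡ a × j ≡ b
=ᶠ-pair e = let (ia , jb) = ∧-true e in =ᶠ⇒≡ ia , =ᶠ⇒≡ jb

theEdge-ends : ∀ {n} {a b i j : Fin n} → theEdge a b i j ≡ true → (i ≡ a × j ≡ b) ⊎ (i ≡ b × j ≡ a)
theEdge-ends {a = a} {b} {i} {j} e with i =ᶠ a in ia | j =ᶠ b in jb
... | true | true = inj₁ (=ᶠ⇒≡ ia , =ᶠ⇒≡ jb)
... | true | false = inj₂ (=ᶠ-pair e)
... | false | _ = inj₂ (=ᶠ-pair e)

deleteEdge-sym : ∀ {n} {F : EdgeRel n} (a b : Fin n) → Symmetric F → Symmetric (deleteEdge F a b)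
deleteEdge-sym {F = F} a b F-sym i j
  rewrite F-sym i j | ∧-comm (i =ᶠ a) (j =ᶠ b) | ∧-comm (i =ᶠ b) (j =ᶠ a)
        | ∨-comm (j =ᶠ b ∧ i =ᶠ a) (j =ᶠ a ∧ i =ᶠ b) = refl

edgeCount-theEdge : ∀ {n} (a b : Fin n) → (a ≺ b) ≡ true → edgeCount (theEdge a b) ≡ 1
edgeCount-theEdge {n} a b a≺b = begin
    edgeCount (theEdge a b)
  ≡⟨ edgeCount≡∑∑ (theEdge a b) ⟩
    ∑[ i < n ] ∑[ j < n ] edgeTerm (theEdge a b) i j
  ≡⟨ sum-cong-≗ (λ i → trans (sum-cong-≗ (atPoint i)) (∑-point (λ _ → if i =ᶠ a then 1 else 0) b)) ⟩
    ∑[ i < n ] (if i =ᶠ a then 1 else 0)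
  ≡⟨ ∑-point (λ _ → 1) a ⟩
    1
  ∎
  where
  open ≡-Reasoning
  a≢b : ¬ a ≡ b
  a≢b refl with trans (sym (≺-irrefl a)) a≺b
  ... | ()
  atPoint : ∀ i j → edgeTerm (theEdge a b) i j ≡ (if j =ᶠ b then (if i =ᶠ a then 1 else 0) else 0)
  atPoint i j with i ≟ a | j ≟ b
  ... | yes refl | yes refl rewrite a≺b = refl
  ... | yes refl | no _ rewrite dec-false (a ≟ b) a≢b | ∧-zeroʳ (a ≺ j) = refl
  ... | no _ | yes refl rewrite dec-false (b ≟ a) (a≢b ∘ sym) | ∧-zeroʳ (i =ᶠ b) | ∧-zeroʳ (i ≺ b) = refl
  ... | no _ | no _ with i ≟ b | j ≟ a
  ...   | yes refl | yes refl rewrite ≺-asym a b a≺b = refl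
  ...   | yes refl | no _ rewrite ∧-zeroʳ (b ≺ j) = refl
  ...   | no _ | _ rewrite ∧-zeroʳ (i ≺ j) = refl

edgeCount-deleteEdge : ∀ {n} (F : EdgeRel n) {a b : Fin n} → Symmetric F → (a ≺ b) ≡ true → F a b ≡ true →
  edgeCount F ≡ suc (edgeCount (deleteEdge F a b))
edgeCount-deleteEdge {n} F {a} {b} F-sym a≺b Fab = begin
    edgeCount F
  ≡⟨ edgeCount≡∑∑ F ⟩
    ∑[ i < n ] ∑[ j < n ] edgeTerm F i j
  ≡⟨ sum-cong-≗ (λ i → trans (sum-cong-≗ (split i)) (∑-distrib-+ (edgeTerm (theEdge a b) i) (edgeTerm F′ i))) ⟩
    ∑[ i < n ] (∑[ j < n ] edgeTerm (theEdge a b) i j + ∑[ j < n ] edgeTerm F′ i j)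
  ≡⟨ ∑-distrib-+ (λ i → ∑[ j < n ] edgeTerm (theEdge a b) i j) (λ i → ∑[ j < n ] edgeTerm F′ i j) ⟩
    ∑[ i < n ] ∑[ j < n ] edgeTerm (theEdge a b) i j + ∑[ i < n ] ∑[ j < n ] edgeTerm F′ i j
  ≡⟨ cong₂ _+_ (trans (sym (edgeCount≡∑∑ (theEdge a b))) (edgeCount-theEdge a b a≺b)) (sym (edgeCount≡∑∑ F′)) ⟩
    suc (edgeCount F′)
  ∎
  where
  open ≡-Reasoning
  F′ = deleteEdge F a b
  edge⊆F : ∀ i j → theEdge a b i j ≡ true → F i j ≡ true
  edge⊆F i j e with theEdge-ends {a = a} {b} {i} {j} e
  ... | inj₁ (refl , refl) = Fab
  ... | inj₂ (refl , refl) = trans (F-sym b a) Fab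
  split : ∀ i j → edgeTerm F i j ≡ edgeTerm (theEdge a b) i j + edgeTerm F′ i j
  split i j with theEdge a b i j in e
  ... | true rewrite edge⊆F i j e | ∧-zeroʳ (i ≺ j) with i ≺ j
  ...   | true = refl
  ...   | false = refl
  split i j | false rewrite ∧-zeroʳ (i ≺ j) | ∧-identityʳ (F i j) = refl

edge-witness : ∀ {n} (F : EdgeRel n) → 0 < edgeCount F → ∃ λ a → ∃ λ b → (a ≺ b) ≡ true × F a b ≡ true
edge-witness {n} F pos =
  let (a , rowPos) = ∑-witness (λ i → ∑[ j < n ] edgeTerm F i j) (subst (0 <_) (edgeCount≡∑∑ F) pos)
      (b , termPos) = ∑-witness (edgeTerm F a) rowPos
  in a , b , ∧-true (positive termPos)
  where
  positive : ∀ {x} → 0 < 𝟙 x → x ≡ true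
  positive {true} _ = refl

trim : ∀ {n} (F : EdgeRel n) → Symmetric F → ∀ k → k ≤ edgeCount F →
  ∃ λ F′ → Symmetric F′ × (∀ i j → F′ i j ≡ true → F i j ≡ true) × edgeCount F′ ≡ k
trim {n} F F-sym k k≤e = trimBy (edgeCount F ∸ k) F F-sym (sym (m+[n∸m]≡n k≤e))
  where
  trimBy : ∀ d (F : EdgeRel n) → Symmetric F → edgeCount F ≡ k + d →
    ∃ λ F′ → Symmetric F′ × (∀ i j → F′ i j ≡ true → F i j ≡ true) × edgeCount F′ ≡ k
  trimBy zero F F-sym e = F , F-sym , (λ _ _ Fij → Fij) , trans e (+-identityʳ k)
  trimBy (suc d) F F-sym e =
    let (a , b , a≺b , Fab) = edge-witness F (subst (0 <_) (sym e) (≤-trans (s≤s z≤n) (m≤n+m (suc d) k)))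
        e′ = suc-injective (trans (sym (edgeCount-deleteEdge F F-sym a≺b Fab)) (trans e (+-suc k d)))
        (F′ , F′-sym , F′⊆ , count′) = trimBy d (deleteEdge F a b) (deleteEdge-sym a b F-sym) e′
    in F′ , F′-sym , (λ i j F′ij → proj₁ (∧-true (F′⊆ i j F′ij))) , count′

Searchable : Set → Set₁
Searchable A = ∀ {P : A → Set} → (∀ x → Dec (P x)) → Dec (∃ P)

subsets-searchable : ∀ {n} → Searchable (Subset n)
subsets-searchable = anySubset?

vectors-searchable : ∀ {A : Set} → Searchable A → ∀ m → Searchable (Vec A m)
vectors-searchable search zero P? = Dec.map′ ([] ,_) (λ { ([] , p) → p }) (P? [])
vectors-searchable search (suc m) P? =
  Dec.map′ (λ (x , xs , p) → x ∷ xs , p) (λ { (x ∷ xs , p) → x , xs , p })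
           (search (λ x → vectors-searchable search m (λ xs → P? (x ∷ xs))))

edgeRels-searchable : ∀ {n} {P : EdgeRel n → Set} → (∀ F → Dec (P F)) →
  (∀ {F H} → (∀ i j → F i j ≡ H i j) → P F → P H) → Dec (∃ P)
edgeRels-searchable {n} P? P-resp =
  Dec.map′ (λ (rows , p) → toRel rows , p)
           (λ (F , p) → tabulate (λ i → tabulate (F i)) , P-resp (λ i j → sym (table F i j)) p)
           (vectors-searchable subsets-searchable n (P? ∘ toRel))
  where
  toRel : Vec (Subset n) n → EdgeRel n
  toRel rows i j = lookup (lookup rows i) j
  table : ∀ (F : EdgeRel n) i j → toRel (tabulate (λ i → tabulate (F i))) i j ≡ F i j
  table F i j = trans (cong (λ row → lookup row j) (lookup∘tabulate (λ i → tabulate (F i)) i))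
                      (lookup∘tabulate (F i) j)

minimise : ∀ {A : Set} → Searchable A → (μ : A → ℕ) → {P : A → Set} → (∀ x → Dec (P x)) →
  ∃ P → ∃ λ b → P b × (∀ c → P c → μ b ≤ μ c)
minimise {A} search μ {P} P? (a , Pa) = descend (μ a) a Pa ≤-refl
  where
  descend : ∀ k a → P a → μ a ≤ k → ∃ λ b → P b × (∀ c → P c → μ b ≤ μ c)
  descend k a Pa μa≤k with search (λ c → P? c ×-dec μ c <? μ a)
  ... | no noSmaller = a , Pa , λ c Pc → ≮⇒≥ (λ μc<μa → noSmaller (c , Pc , μc<μa))
  descend zero a Pa μa≤0 | yes (c , _ , μc<μa) = ⊥-elim (n≮0 (≤-trans μc<μa μa≤0))
  descend (suc k) a Pa μa≤k | yes (c , Pc , μc<μa) = descend k c Pc (≤-pred (≤-trans μc<μa μa≤k))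

maximise : ∀ {A : Set} → Searchable A → (μ : A → ℕ) (N : ℕ) → (∀ x → μ x ≤ N) →
  {P : A → Set} → (∀ x → Dec (P x)) → ∃ P → ∃ λ b → P b × (∀ c → P c → μ c ≤ μ b)
maximise search μ N bounded P? witness =
  let (b , Pb , least) = minimise search (λ x → N ∸ μ x) P? witness
  in b , Pb , λ c Pc → subst₂ _≤_ (m∸[m∸n]≡n (bounded c)) (m∸[m∸n]≡n (bounded b))
                                  (∸-monoʳ-≤ N (least c Pc))

open SubgraphOf

subgraph-mono : ∀ {n} {T S : Subset n} {H H′ F : EdgeRel n} →
  (∀ i j → H i j ≡ true → H′ i j ≡ true) → SubgraphOf T H S F → SubgraphOf T H′ S F
subgraph-mono H⊆H′ sub = record
  { vertices⊆ = vertices⊆ sub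
  ; edgeSym = edgeSym sub
  ; edges⊆ = λ i j Fij → H⊆H′ i j (edges⊆ sub i j Fij)
  ; endpoints = endpoints sub }

subgraph-resp : ∀ {n} {T S : Subset n} {H F F′ : EdgeRel n} → (∀ i j → F i j ≡ F′ i j) →
  SubgraphOf T H S F → SubgraphOf T H S F′
subgraph-resp F≡F′ sub = record
  { vertices⊆ = vertices⊆ sub
  ; edgeSym = λ i j → trans (sym (F≡F′ i j)) (trans (edgeSym sub i j) (F≡F′ j i))
  ; edges⊆ = λ i j F′ij → edges⊆ sub i j (trans (F≡F′ i j) F′ij)
  ; endpoints = λ i j F′ij → endpoints sub i j (trans (F≡F′ i j) F′ij) }

subgraph⊆restrict : ∀ {n} {T S : Subset n} {H F : EdgeRel n} → SubgraphOf T H S F →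
  ∀ i j → F i j ≡ true → restrict H S i j ≡ true
subgraph⊆restrict sub i j Fij
  rewrite edges⊆ sub i j Fij | ∈⇒true (proj₁ (endpoints sub i j Fij)) | ∈⇒true (proj₂ (endpoints sub i j Fij)) = refl

restrict-subgraph : ∀ {n} {T S : Subset n} {H : EdgeRel n} → Symmetric H → S ⊆ T → SubgraphOf T H S (restrict H S)
restrict-subgraph {S = S} {H} H-sym S⊆T = record
  { vertices⊆ = S⊆T
  ; edgeSym = restrict-sym S H-sym
  ; edges⊆ = λ i j → restrict⊆ H S
  ; endpoints = λ i j → restrict-ends H S }

Overfull : ∀ {n} → EdgeRel n → Subset n → Set
Overfull H S = 2 ≤ ∣ S ∣ × 2 * ∣ S ∣ < edgeCount (restrict H S) + 3

Overfull? : ∀ {n} (H : EdgeRel n) (S : Subset n) → Dec (Overfull H S)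
Overfull? H S = (2 ≤? ∣ S ∣) ×-dec (2 * ∣ S ∣ <? edgeCount (restrict H S) + 3)

-- Laman sparsity is decided on induced subgraphs: either H is sparse on T,
-- or some vertex set S ⊆ T is overfull.
sparse-or-overfull : ∀ {n} (T : Subset n) (H : EdgeRel n) → LamanSparse T H ⊎ ∃ λ S → S ⊆ T × Overfull H S
sparse-or-overfull T H with subsets-searchable (λ S → (S ⊆? T) ×-dec Overfull? H S)
... | yes (S , S⊆T , overfull) = inj₂ (S , S⊆T , overfull)
... | no none = inj₁ λ S F sub two →
  ≤-trans (+-monoˡ-≤ 3 (edgeCount-mono (subgraph⊆restrict sub)))
          (≮⇒≥ λ overfull → none (S , vertices⊆ sub , two , overfull))

overfull⇒¬sparse : ∀ {n} {T S : Subset n} {H : EdgeRel n} → Symmetric H → S ⊆ T → Overfull H S → ¬ LamanSparse T H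
overfull⇒¬sparse {S = S} {H} H-sym S⊆T (two , overfull) sparse =
  <⇒≱ overfull (sparse S (restrict H S) (restrict-subgraph H-sym S⊆T) two)

LamanSparse? : ∀ {n} (T : Subset n) (H : EdgeRel n) → Symmetric H → Dec (LamanSparse T H)
LamanSparse? T H H-sym with sparse-or-overfull T H
... | inj₁ sparse = yes sparse
... | inj₂ (S , S⊆T , overfull) = no (overfull⇒¬sparse H-sym S⊆T overfull)

SubgraphOf? : ∀ {n} (T : Subset n) (H : EdgeRel n) (S : Subset n) (F : EdgeRel n) → Dec (SubgraphOf T H S F)
SubgraphOf? T H S F =
  Dec.map′ (λ (S⊆T , F-sym , F⊆H , ends) → record { vertices⊆ = λ {x} → S⊆T {x} ; edgeSym = F-sym ; edges⊆ = F⊆H ; endpoints = ends })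
           (λ sub → (λ {x} → vertices⊆ sub {x}) , edgeSym sub , edges⊆ sub , endpoints sub)
           ((S ⊆? T) ×-dec
            all? (λ i → all? (λ j → F i j Bool.≟ F j i)) ×-dec
            all? (λ i → all? (λ j → (F i j Bool.≟ true) →-dec (H i j Bool.≟ true))) ×-dec
            all? (λ i → all? (λ j → (F i j Bool.≟ true) →-dec ((i ∈? S) ×-dec (j ∈? S)))))

Laman? : ∀ {n} (T : Subset n) (H : EdgeRel n) → Symmetric H → Dec (Laman T H)
Laman? T H H-sym = LamanSparse? T H H-sym ×-dec (edgeCount H + 3 ≟ℕ 2 * ∣ T ∣)

spanningLaman-resp : ∀ {n} {T : Subset n} {H F F′ : EdgeRel n} → (∀ i j → F i j ≡ F′ i j) →
  SubgraphOf T H T F × Laman T F → SubgraphOf T H T F′ × Laman T F′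
spanningLaman-resp F≡F′ (sub , sparse , tight) =
  subgraph-resp F≡F′ sub ,
  (λ S F″ sub″ → sparse S F″ (subgraph-mono (λ i j → trans (F≡F′ i j)) sub″)) ,
  trans (cong (_+ 3) (sym (edgeCount-cong F≡F′))) tight

RigidBlock? : ∀ {n} (G : SimpleGraph n) (R : Subset n) → Dec (RigidBlock G R)
RigidBlock? G R = edgeRels-searchable spanningLaman? spanningLaman-resp
  where
  spanningLaman? : ∀ F → Dec (SubgraphOf R (inducedEdges G R) R F × Laman R F)
  spanningLaman? F with SubgraphOf? R (inducedEdges G R) R F
  ... | no notSub = no (notSub ∘ proj₁)
  ... | yes sub = Dec.map′ (sub ,_) proj₂ (Laman? R F (edgeSym sub))

module GraphFacts {n : ℕ} (G : SimpleGraph n) where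

  induced-sym : ∀ S → Symmetric (inducedEdges G S)
  induced-sym S = restrict-sym S (adj-sym G)

  adjacent⇒distinct : ∀ {u w : Fin n} → adj G u w ≡ true → ¬ u ≡ w
  adjacent⇒distinct {u} uw refl with trans (sym (irrefl G u)) uw
  ... | ()

  edgeCount-induced-∖ : ∀ {S : Subset n} {v} → v ∈ S →
    edgeCount (inducedEdges G S) ≡ degIn G S v + edgeCount (inducedEdges G (S ∖ v))
  edgeCount-induced-∖ {S} {v} = edgeCount-restrict-∖ (adj G) S (adj-sym G) (irrefl G v)

  degree-bound : ∀ {S : Subset n} {v} → v ∈ S → degIn G S v < ∣ S ∣
  degree-bound {S} {v} v∈S = begin-strict
      degIn G S v
    ≤⟨ count-mono others ⟩
      count (λ u → lookup S u ∧ not (u =ᶠ v))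
    <⟨ ≤-refl ⟩
      𝟙 true + count (λ u → lookup S u ∧ not (u =ᶠ v))
    ≡⟨ cong (λ b → 𝟙 b + count (λ u → lookup S u ∧ not (u =ᶠ v))) (∈⇒true v∈S) ⟨
      𝟙 (lookup S v) + count (λ u → lookup S u ∧ not (u =ᶠ v))
    ≡⟨ trans (∣∣≡count S) (count-remove (lookup S) v) ⟨
      ∣ S ∣
    ∎
    where
    open ≤-Reasoning
    others : ∀ u → (adj G v u ∧ lookup S u) ≡ true → (lookup S u ∧ not (u =ᶠ v)) ≡ true
    others u e = let (vu , Su) = ∧-true e in
      cong₂ _∧_ Su (cong not (dec-false (u ≟ v) (adjacent⇒distinct vu ∘ sym)))

  degIn-mono : ∀ {A B : Subset n} v → A ⊆ B → degIn G A v ≤ degIn G B v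
  degIn-mono {A} {B} v A⊆B = count-mono neighbour
    where
    neighbour : ∀ u → (adj G v u ∧ lookup A u) ≡ true → (adj G v u ∧ lookup B u) ≡ true
    neighbour u e = let (vu , Au) = ∧-true e in cong₂ _∧_ vu (∈⇒true (A⊆B (true⇒∈ Au)))

  -- G[S] has at most |S| choose 2 edges: by induction on |S|, deleting a vertex, which
  -- has fewer than |S| neighbours.
  edge-bound : ∀ S → 2 * edgeCount (inducedEdges G S) + ∣ S ∣ ≤ ∣ S ∣ * ∣ S ∣
  edge-bound S = bound ∣ S ∣ S refl
    where
    grow : ∀ d e m → d ≤ m → 2 * e + m ≤ m * m → 2 * (d + e) + suc m ≤ suc m * suc m
    grow d e m d≤m IH = begin
        2 * (d + e) + suc m
      ≡⟨ regroup d e m ⟩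
        2 * d + (2 * e + m) + 1
      ≤⟨ +-monoˡ-≤ 1 (+-mono-≤ (*-monoʳ-≤ 2 d≤m) IH) ⟩
        2 * m + m * m + 1
      ≡⟨ square m ⟩
        suc m * suc m
      ∎
      where
      open ≤-Reasoning
      regroup : ∀ d e m → 2 * (d + e) + suc m ≡ 2 * d + (2 * e + m) + 1
      regroup = solve-∀
      square : ∀ m → 2 * m + m * m + 1 ≡ suc m * suc m
      square = solve-∀
    bound : ∀ k S → ∣ S ∣ ≡ k → 2 * edgeCount (inducedEdges G S) + k ≤ k * k
    bound zero S empty = ≤-reflexive (cong (λ e → 2 * e + 0) noEdges)
      where
      noEdges : edgeCount (inducedEdges G S) ≡ 0
      noEdges = n≤0⇒n≡0 (≮⇒≥ λ pos →
        let (a , _ , _ , e) = edge-witness (inducedEdges G S) pos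
        in 1+n≰n (≤-trans (subst (1 ≤_) (∣∖∣ (proj₁ (restrict-ends (adj G) S e))) (s≤s z≤n)) (≤-reflexive empty)))
    bound (suc m) S size =
      let (v , v∈S) = member S (subst (0 <_) (sym size) (s≤s z≤n))
          size′ = suc-injective (trans (∣∖∣ v∈S) size)
      in subst (λ e → 2 * e + suc m ≤ suc m * suc m) (sym (edgeCount-induced-∖ v∈S))
               (grow (degIn G S v) (edgeCount (inducedEdges G (S ∖ v))) m (≤-pred (subst (degIn G S v <_) size (degree-bound v∈S))) (bound m (S ∖ v) size′))

  -- Two vertices span at most one edge, so an overfull set has at least three vertices.
  overfull⇒3≤ : ∀ {S : Subset n} → Overfull (adj G) S → 3 ≤ ∣ S ∣
  overfull⇒3≤ {S} (two , overfull) = ≤∧≢⇒< two λ 2≡∣S∣ →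
    let e = edgeCount (inducedEdges G S)
        bound : 2 * e + 2 ≤ 4
        bound = subst (λ k → 2 * e + k ≤ k * k) (sym 2≡∣S∣) (edge-bound S)
        many : 2 ≤ e
        many = +-cancelʳ-≤ 3 2 e (subst (λ k → 2 * k < e + 3) (sym 2≡∣S∣) overfull)
    in 6≰4 (≤-trans (+-monoˡ-≤ 2 (*-monoʳ-≤ 2 many)) bound)
    where
    6≰4 : ¬ 6 ≤ 4
    6≰4 (s≤s (s≤s (s≤s (s≤s ()))))

  overfull-∖ : ∀ {S : Subset n} {v} → Overfull (adj G) S → v ∈ S → degIn G S v ≤ 2 → Overfull (adj G) (S ∖ v)
  overfull-∖ {S} {v} overfullS v∈S low =
    ≤-pred (subst (3 ≤_) (sym (∣∖∣ v∈S)) (overfull⇒3≤ {S} overfullS)) ,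
    +-cancelˡ-< 2 (2 * ∣ S ∖ v ∣) (e′ + 3) (begin-strict
      2 + 2 * ∣ S ∖ v ∣
    ≡⟨ *-suc 2 ∣ S ∖ v ∣ ⟨
      2 * suc ∣ S ∖ v ∣
    ≡⟨ cong (2 *_) (∣∖∣ v∈S) ⟩
      2 * ∣ S ∣
    <⟨ proj₂ overfullS ⟩
      edgeCount (inducedEdges G S) + 3
    ≡⟨ cong (_+ 3) (edgeCount-induced-∖ v∈S) ⟩
      degIn G S v + e′ + 3
    ≤⟨ +-monoˡ-≤ 3 (+-monoˡ-≤ e′ low) ⟩
      2 + e′ + 3
    ≡⟨ +-assoc 2 e′ 3 ⟩
      2 + (e′ + 3)
    ∎)
    where
    open ≤-Reasoning
    e′ = edgeCount (inducedEdges G (S ∖ v))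

  module MinimalOverfull (S : Subset n) (overfullS : Overfull (adj G) S)
                         (minimal : ∀ S′ → Overfull (adj G) S′ → ∣ S ∣ ≤ ∣ S′ ∣) where

    -- A vertex of degree at most two could be deleted to give a smaller overfull set.
    minDegree3 : MinDegree3 G S
    minDegree3 v v∈S with 3 ≤? degIn G S v
    ... | yes high = high
    ... | no low = ⊥-elim (1+n≰n (subst (_≤ ∣ S ∖ v ∣) (sym (∣∖∣ v∈S))
                    (minimal (S ∖ v) (overfull-∖ overfullS v∈S (≤-pred (≰⇒> low))))))

    four≤∣S∣ : 4 ≤ ∣ S ∣
    four≤∣S∣ = let (v , v∈S) = member S (≤-trans (s≤s z≤n) (proj₁ overfullS))
               in ≤-trans (s≤s (minDegree3 v v∈S)) (degree-bound v∈S)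

    -- Any 2|S| - 3 edges of G[S] form a spanning Laman subgraph: a subgraph on fewer
    -- vertices obeys the count because no smaller set is overfull, a subgraph on at
    -- least |S| vertices because it has at most 2|S| - 3 edges.
    spanningLaman : ∀ (L : EdgeRel n) → Symmetric L → (∀ i j → L i j ≡ true → inducedEdges G S i j ≡ true) →
      edgeCount L ≡ 2 * ∣ S ∣ ∸ 3 → SubgraphOf S (inducedEdges G S) S L × Laman S L
    spanningLaman L L-sym L⊆ size = subgraph , sparse , tight
      where
      tight : edgeCount L + 3 ≡ 2 * ∣ S ∣
      tight = trans (cong (_+ 3) size) (m∸n+n≡m (≤-trans (s≤s (s≤s (s≤s z≤n))) (*-monoʳ-≤ 2 (proj₁ overfullS))))
      subgraph : SubgraphOf S (inducedEdges G S) S L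
      subgraph = record
        { vertices⊆ = λ x∈S → x∈S
        ; edgeSym = L-sym
        ; edges⊆ = L⊆
        ; endpoints = λ i j Lij → restrict-ends (adj G) S (L⊆ i j Lij) }
      sparse : LamanSparse S L
      sparse S′ F sub two with ∣ S ∣ ≤? ∣ S′ ∣
      ... | yes larger = ≤-trans (+-monoˡ-≤ 3 (edgeCount-mono (edges⊆ sub)))
                                 (≤-trans (≤-reflexive tight) (*-monoʳ-≤ 2 larger))
      ... | no smaller = ≤-trans (+-monoˡ-≤ 3 (edgeCount-mono (subgraph⊆restrict subG)))
                                 (≮⇒≥ λ overfull → smaller (minimal S′ (two , overfull)))
        where
        subG : SubgraphOf S (adj G) S′ F
        subG = subgraph-mono (λ i j Lij → restrict⊆ (adj G) S (L⊆ i j Lij)) sub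

    rigid : RigidBlock G S
    rigid =
      let (L , L-sym , L⊆ , size) = trim (inducedEdges G S) (induced-sym S) (2 * ∣ S ∣ ∸ 3) enough
      in L , spanningLaman L L-sym L⊆ size
      where
      enough : 2 * ∣ S ∣ ∸ 3 ≤ edgeCount (inducedEdges G S)
      enough = subst (2 * ∣ S ∣ ∸ 3 ≤_) (m+n∸n≡m _ 3) (∸-monoˡ-≤ 3 (<⇒≤ (proj₂ overfullS)))

  rigidDenseSet : ¬ GraphLamanSparse G → ∃ λ S → RigidBlock G S × MinDegree3 G S × 4 ≤ ∣ S ∣
  rigidDenseSet notSparse with sparse-or-overfull ⊤ (adj G)
  ... | inj₁ sparse = ⊥-elim (notSparse sparse)
  ... | inj₂ (S₀ , _ , overfull₀) =
    let (S , overfullS , minimal) = minimise subsets-searchable ∣_∣ (Overfull? (adj G)) (S₀ , overfull₀)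
        open MinimalOverfull S overfullS minimal
    in S , rigid , minDegree3 , four≤∣S∣

  largest⇒component : ∀ {S R : Subset n} → RigidBlock G R → S ⊆ R →
    (∀ R′ → S ⊆ R′ × RigidBlock G R′ → ∣ R′ ∣ ≤ ∣ R ∣) → RigidComponent G R
  largest⇒component {S} {R} rigidR S⊆R largest = rigidR , maximal
    where
    maximal : ∀ R′ → RigidBlock G R′ → R ⊆ R′ → R′ ⊆ R
    maximal R′ rigidR′ R⊆R′ {x} x∈R′ with x ∈? R
    ... | yes x∈R = x∈R
    ... | no x∉R = ⊥-elim (<⇒≱ (p⊂q⇒∣p∣<∣q∣ (R⊆R′ , x , x∈R′ , x∉R)) (largest R′ (R⊆R′ ∘ S⊆R , rigidR′)))

  -- The 3-core C absorbs X when no vertex of X outside C has fewer than three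
  -- neighbours in X ∪ C: then X ∪ C has minimum degree three.
  core-absorbs : ∀ {C X : Subset n} → IsThreeCore G C →
    (∀ w → w ∈ X → ¬ w ∈ C → 3 ≤ degIn G (X ∪ C) w) → X ⊆ C
  core-absorbs {C} {X} (minDegC , largestC) high x∈X = largestC (X ∪ C) minDegX∪C (p⊆p∪q C x∈X)
    where
    minDegX∪C : MinDegree3 G (X ∪ C)
    minDegX∪C u u∈X∪C with u ∈? C | x∈p∪q⁻ X C u∈X∪C
    ... | yes u∈C | _ = ≤-trans (minDegC u u∈C) (degIn-mono u (q⊆p∪q X C))
    ... | no u∉C | inj₁ u∈X = high u u∈X u∉C
    ... | no u∉C | inj₂ u∈C = ⊥-elim (u∉C u∈C)

  -- The vertices of a rigid block R, spanned by the Laman graph L and containing a set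
  -- S ⊆ C with at least two vertices, lie in the (3+2)-core: repeatedly delete from the
  -- part of R outside C a vertex with at most two neighbours in it plus C. Every set X
  -- reached stays tight for L, so each deleted vertex had exactly two L-neighbours
  -- among the remaining vertices, which puts it in the (3+2)-core.
  module Peeling {C : Subset n} (threeCore : IsThreeCore G C) {S R : Subset n} (S⊆C : S ⊆ C)
                 (two≤∣S∣ : 2 ≤ ∣ S ∣) (S⊆R : S ⊆ R) (L : EdgeRel n)
                 (spanning : SubgraphOf R (inducedEdges G R) R L) (laman : Laman R L) where

    L-sym : Symmetric L
    L-sym = edgeSym spanning

    L⊆adj : ∀ {i j} → L i j ≡ true → adj G i j ≡ true
    L⊆adj {i} {j} Lij = restrict⊆ (adj G) R (edges⊆ spanning i j Lij)

    L-irrefl : ∀ w → L w w ≡ false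
    L-irrefl w with L w w in Lww
    ... | true = ⊥-elim (adjacent⇒distinct (L⊆adj Lww) refl)
    ... | false = refl

    Tight : Subset n → Set
    Tight X = 2 * ∣ X ∣ ≤ edgeCount (restrict L X) + 3

    degL : Subset n → Fin n → ℕ
    degL X w = count (λ u → L w u ∧ lookup X u)

    -- The arithmetic of peeling: with |X| = x + 1, e(L[X]) = d + e, the sparsity bound
    -- e + 3 ≤ 2x on X - w, and d ≤ 2, tightness of X forces d = 2 and tightness of X - w.
    tight-split : ∀ x d e → 2 * suc x ≤ d + e + 3 → e + 3 ≤ 2 * x → d ≤ 2 → 2 ≤ d × 2 * x ≤ e + 3
    tight-split x d e tight sparse d≤2 =
      +-cancelʳ-≤ (2 * x) 2 d (≤-trans tight′ (+-monoʳ-≤ d sparse)) ,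
      +-cancelˡ-≤ 2 (2 * x) (e + 3) (≤-trans tight′ (+-monoˡ-≤ (e + 3) d≤2))
      where
      tight′ : 2 + 2 * x ≤ d + (e + 3)
      tight′ = subst₂ _≤_ (*-suc 2 x) (+-assoc d e 3) tight

    -- Deleting a vertex with at most two L-neighbours from a tight set keeps it tight;
    -- by sparsity of L the vertex had exactly two L-neighbours.
    peel-vertex : ∀ {X w} → S ⊆ X ∖ w → X ⊆ R → Tight X → w ∈ X → degL X w ≤ 2 →
      Tight (X ∖ w) × 2 ≤ degL X w
    peel-vertex {X} {w} S⊆X∖w X⊆R tight w∈X low =
      let (two , tight′) = tight-split ∣ X ∖ w ∣ (degL X w) e′ tightX sparseX∖w low in tight′ , two
      where
      e′ = edgeCount (restrict L (X ∖ w))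
      tightX : 2 * suc ∣ X ∖ w ∣ ≤ degL X w + e′ + 3
      tightX = subst₂ (λ k e → 2 * k ≤ e + 3) (sym (∣∖∣ w∈X))
                      (edgeCount-restrict-∖ L X L-sym (L-irrefl w) w∈X) tight
      sparseX∖w : e′ + 3 ≤ 2 * ∣ X ∖ w ∣
      sparseX∖w = proj₁ laman (X ∖ w) (restrict L (X ∖ w)) (restrict-subgraph L-sym (X⊆R ∘ ∖⊆))
                    (≤-trans two≤∣S∣ (p⊆q⇒∣p∣≤∣q∣ S⊆X∖w))

    peel : ∀ k X → ∣ X ∣ ≤ k → S ⊆ X → X ⊆ R → Tight X → ∀ v → v ∈ X → InCore32 G C v
    peel k X size S⊆X X⊆R tight
      with any? (λ w → (w ∈? X) ×-dec ¬? (w ∈? C) ×-dec (degIn G (X ∪ C) w <? 3))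
    ... | no noLow = λ v v∈X → base (core-absorbs threeCore (λ w w∈X w∉C → ≮⇒≥ λ low → noLow (w , w∈X , w∉C , low)) v∈X)
    peel zero X size S⊆X X⊆R tight | yes (w , w∈X , _) =
      ⊥-elim (n≮0 (≤-trans (≤-reflexive (∣∖∣ w∈X)) size))
    peel (suc k) X size S⊆X X⊆R tight | yes (w , w∈X , w∉C , low) = inCore
      where
      S⊆X∖w : S ⊆ X ∖ w
      S⊆X∖w x∈S = ∈∖ (S⊆X x∈S) λ { refl → w∉C (S⊆C x∈S) }
      lowL : degL X w ≤ 2
      lowL = ≤-trans (count-mono inG) (≤-pred low)
        where
        inG : ∀ u → (L w u ∧ lookup X u) ≡ true → (adj G w u ∧ lookup (X ∪ C) u) ≡ true
        inG u e = let (Lwu , Xu) = ∧-true e in cong₂ _∧_ (L⊆adj Lwu) (∈⇒true (p⊆p∪q C (true⇒∈ {S = X} Xu)))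
      peeled = peel-vertex S⊆X∖w X⊆R tight w∈X lowL
      rest : ∀ u → u ∈ X ∖ w → InCore32 G C u
      rest = peel k (X ∖ w) (≤-pred (≤-trans (≤-reflexive (∣∖∣ w∈X)) size)) S⊆X∖w (X⊆R ∘ ∖⊆) (proj₁ peeled)
      neighbour : ∀ u → (L w u ∧ lookup X u) ≡ true → adj G w u ≡ true × InCore32 G C u
      neighbour u e = let (Lwu , Xu) = ∧-true e in
        L⊆adj Lwu , rest u (∈∖ (true⇒∈ {S = X} Xu) (adjacent⇒distinct (L⊆adj Lwu) ∘ sym))
      inCore : ∀ v → v ∈ X → InCore32 G C v
      inCore v v∈X with v ≟ w
      ... | no v≢w = rest v (∈∖ v∈X v≢w)
      ... | yes refl =
        let (u₁ , u₂ , u₁≢u₂ , e₁ , e₂) = count-two (λ u → L w u ∧ lookup X u) (proj₂ peeled)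
            (wu₁ , u₁-in) = neighbour u₁ e₁
            (wu₂ , u₂-in) = neighbour u₂ e₂
        in step u₁ u₂ u₁≢u₂ wu₁ wu₂ u₁-in u₂-in

    -- R itself is tight, since L spans R with 2|R| - 3 edges.
    inCore : ∀ v → v ∈ R → InCore32 G C v
    inCore = peel ∣ R ∣ R ≤-refl S⊆R (λ x∈R → x∈R) (≤-reflexive (sym (trans (cong (_+ 3) (edgeCount-cong onR)) (proj₂ laman))))
      where
      onR : ∀ i j → restrict L R i j ≡ L i j
      onR i j with L i j in Lij
      ... | false = refl
      ... | true = let (i∈R , j∈R) = endpoints spanning i j Lij in cong₂ _∧_ (∈⇒true i∈R) (∈⇒true j∈R)

mainTheorem4 : ∀ {n} (G : SimpleGraph n) → ¬ GraphLamanSparse G →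
    (C : Subset n) → IsThreeCore G C →
    Σ (Subset n) (λ R → RigidComponent G R × 4 ≤ ∣ R ∣ × (∀ v → v ∈ R → InCore32 G C v))
mainTheorem4 {n} G notSparse C threeCore@(_ , largestC) =
  let (S , rigidS , minDegS , four≤∣S∣) = rigidDenseSet notSparse
      (R , (S⊆R , rigidR) , largest) =
        maximise subsets-searchable ∣_∣ n ∣p∣≤n (λ R → (S ⊆? R) ×-dec RigidBlock? G R) (S , (λ x∈S → x∈S) , rigidS)
      (L , spanning , laman) = rigidR
  in R ,
     largest⇒component rigidR S⊆R largest ,
     ≤-trans four≤∣S∣ (p⊆q⇒∣p∣≤∣q∣ S⊆R) ,
     Peeling.inCore threeCore (largestC S minDegS) (≤-trans (s≤s (s≤s z≤n)) four≤∣S∣) S⊆R L spanning laman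
  where open GraphFacts G
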